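{- Let $L$ be a finite lattice and $\mathrm{Int}(L)=\{(x,y):x\le y\}$ its set of intervals, partially ordered by $(x,y)\le(x',y')$ iff $x\le x'$ and $y\le y'$ (a lattice under componentwise meet and join). Then for $(x,y)\le(x',y')$ in $\mathrm{Int}(L)$, $$\mu_{\mathrm{Int}(L)}((x,y),(x',y'))=\begin{cases}\mu_L(x,x')\,\mu_L(y,y'),&\text{if }x'\le y,\\ 0,&\text{otherwise.}\end{cases}$$
   Context: $\mu_L$ and $\mu_{\mathrm{Int}(L)}$ denote the Möbius functions of $L$ and $\mathrm{Int}(L)$. -}

module Defs where

open import Data.Bool using (Bool; true; false; if_then_else_; _∧_; not)
open import Data.Nat using (ℕ; zero; suc)
open import Data.Integer using (ℤ; _+_; _*_; -_; 0ℤ; 1ℤ)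
open import Data.Fin using (Fin)
open import Data.Fin.Properties using () renaming (_≟_ to _≟ᶠ_)
open import Data.List using (List; []; _∷_; foldr; map; length; filter; concatMap; allFin)
open import Data.Product using (_×_; _,_)
open import Data.Product.Properties using (≡-dec)
open import Relation.Nullary using (yes; no; Dec)
open import Relation.Nullary.Decidable using (⌊_⌋)
open import Relation.Binary.Definitions using (DecidableEquality; Decidable)

sumℤ : List ℤ → ℤ
sumℤ = foldr _+_ 0ℤ

-- Möbius function of a finite poset presented by:
--   decidable equality on the carrier, a boolean order test `le`
--   (le a b = true iff a ≤ b), and a duplicate-free list `elems`
--   of all its elements.
-- The recursion is made structural by a fuel argument; fuel
-- (suc (length elems)) exceeds the length of every strict chain, so
-- it is never exhausted.
module Möbius {A : Set} (_≟_ : DecidableEquality A) (le : A → A → Bool) (elems : List A) where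

  mobF : ℕ → A → A → ℤ
  mobF zero    x y = 0ℤ
  mobF (suc k) x y with x ≟ y
  ... | yes _ = 1ℤ
  ... | no  _ = if le x y
                then - sumℤ (map (λ z → if le x z ∧ le z y ∧ not ⌊ z ≟ y ⌋
                                        then mobF k x z else 0ℤ) elems)
                else 0ℤ

  μ : A → A → ℤ
  μ = mobF (suc (length elems))

-- A finite lattice is given (up to isomorphism) on the carrier Fin n,
-- with a decidable order _≤_.
module FinLattice {n : ℕ} (_≤_ : Fin n → Fin n → Set) (_≤?_ : Decidable _≤_) where

  leL : Fin n → Fin n → Bool
  leL x y = ⌊ x ≤? y ⌋

  μL : Fin n → Fin n → ℤ
  μL = Möbius.μ _≟ᶠ_ leL (allFin n)

  intervals : List (Fin n × Fin n)
  intervals = filter (λ p → let (x , y) = p in x ≤? y)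
                     (concatMap (λ x → map (λ y → (x , y)) (allFin n)) (allFin n))

  leInt : Fin n × Fin n → Fin n × Fin n → Bool
  leInt (x , y) (x' , y') = leL x x' ∧ leL y y'

  μInt : Fin n × Fin n → Fin n × Fin n → ℤ
  μInt = Möbius.μ (≡-dec _≟ᶠ_ _≟ᶠ_) leInt intervals

module Submission where

-- The proof is the classical "guess and verify" argument.
--
-- For a finite lattice L and a fixed interval (x₀,y₀) we then consider the
-- candidate  G(a,b) = [a ≤ y₀] μ_L(x₀,a) μ_L(y₀,b).  For (c,d) ∈ Int(L) the
-- constraints (x₀,y₀) ≤ (c,d) ≤ (a,b) together with c ≤ y₀ are equivalent to
-- x₀ ≤ c ≤ a ∧ y₀ and y₀ ≤ d ≤ b (the condition c ≤ d is then automatic), so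
-- the closed-interval sum of G factorises into δ(x₀, a ∧ y₀) δ(y₀, b), which
-- equals δ((x₀,y₀),(a,b)).  Uniqueness gives μ_Int = G, which is the theorem.

open import Defs
open import Algebra.Core using (Op₂)
open import Level using (0ℓ)
open import Data.Bool using (Bool; true; false; if_then_else_; not) renaming (_∧_ to _&&_)
open import Data.Nat using (ℕ; suc; _<_; _≤_; z≤n; s≤s)
import Data.Nat.Properties as ℕₚ
open import Data.Fin using (Fin)
open import Data.Fin.Properties using () renaming (_≟_ to _≟ᶠ_)
open import Data.Integer using (ℤ; _+_; _*_; -_; 0ℤ; 1ℤ)
import Data.Integer.Properties as ℤₚ
open import Algebra.Properties.AbelianGroup ℤₚ.+-0-abelianGroup using (inverseʳ-unique)
open import Algebra.Properties.CommutativeSemigroup ℤₚ.+-commutativeSemigroup using (interchange)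
open import Data.List using (List; []; _∷_; _++_; map; length; filter; concatMap; allFin; cartesianProduct)
import Data.List.Properties as Listₚ
open import Data.List.Membership.Propositional using (_∈_)
open import Data.List.Membership.Propositional.Properties
  using (∈-filter⁺; ∈-filter⁻; ∈-cartesianProduct⁺; ∈-allFin)
open import Data.List.Relation.Unary.All as All using ()
open import Data.List.Relation.Unary.AllPairs using (_∷_)
open import Data.List.Relation.Unary.Any using (here; there)
open import Data.List.Relation.Unary.Unique.Propositional using (Unique)
open import Data.List.Relation.Unary.Unique.Propositional.Properties
  using (filter⁺; cartesianProduct⁺; allFin⁺)
open import Data.Product using (_×_; _,_; proj₁; proj₂)
open import Data.Product.Properties using (≡-dec)
open import Data.Empty using (⊥-elim)
open import Function using (_∘_)
open import Relation.Nullary using (¬_; Dec; yes; no; does)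
open import Relation.Nullary.Decidable using (⌊_⌋; isYes≗does)
open import Relation.Unary using (Pred) renaming (Decidable to Decidable₁)
open import Relation.Binary.PropositionalEquality
open import Relation.Binary.Definitions using (DecidableEquality; Decidable)
open import Relation.Binary.Lattice.Structures using (IsLattice)

open ≡-Reasoning

module _ {P : Set} where

  ⌊⌋-true : (P? : Dec P) → P → ⌊ P? ⌋ ≡ true
  ⌊⌋-true (yes _) p = refl
  ⌊⌋-true (no ¬p) p = ⊥-elim (¬p p)

  ⌊⌋-false : (P? : Dec P) → ¬ P → ⌊ P? ⌋ ≡ false
  ⌊⌋-false (yes p) ¬p = ⊥-elim (¬p p)
  ⌊⌋-false (no _)  ¬p = refl

  ⌊⌋-sound : (P? : Dec P) → ⌊ P? ⌋ ≡ true → P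
  ⌊⌋-sound (yes p) _ = p

  not⌊⌋-sound : (P? : Dec P) → not ⌊ P? ⌋ ≡ true → ¬ P
  not⌊⌋-sound (no ¬p) _ = ¬p

&&-true : ∀ {a b} → a && b ≡ true → a ≡ true × b ≡ true
&&-true {true} e = refl , e

-- Indicator notation:  [ b ]· v  is v if b holds and 0 otherwise
-- (definitionally the  if b then v else 0ℤ  used in Defs).
infixr 8 [_]·_
[_]·_ : Bool → ℤ → ℤ
[ b ]· v = if b then v else 0ℤ

-- Removing the top element y from the closed interval [x, y]:
-- the three booleans stand for x ≤ z, z ≤ y and z = y.
split-top : ∀ (p q r : Bool) (v : ℤ) →
  [ p && q ]· v ≡ [ p && q && not r ]· v + [ r ]· [ p && q ]· v
split-top true  true  false v = sym (ℤₚ.+-identityʳ v)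
split-top true  true  true  v = sym (ℤₚ.+-identityˡ v)
split-top true  false r     v with r
... | true = refl
... | false = refl
split-top false q     r     v with r
... | true = refl
... | false = refl

∑ : {A : Set} → List A → (A → ℤ) → ℤ
∑ xs f = sumℤ (map f xs)
infixr 7 ∑
syntax ∑ xs (λ z → e) = ∑[ z ← xs ] e

module _ {A : Set} where

  ∑-cong-∈ : ∀ (xs : List A) {f g : A → ℤ} → (∀ {z} → z ∈ xs → f z ≡ g z) → ∑ xs f ≡ ∑ xs g
  ∑-cong-∈ []       f≗g = refl
  ∑-cong-∈ (x ∷ xs) f≗g = cong₂ _+_ (f≗g (here refl)) (∑-cong-∈ xs (f≗g ∘ there))

  ∑-cong : ∀ (xs : List A) {f g : A → ℤ} → (∀ z → f z ≡ g z) → ∑ xs f ≡ ∑ xs g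
  ∑-cong xs f≗g = ∑-cong-∈ xs (λ {z} _ → f≗g z)

  ∑-zero : ∀ (xs : List A) {f : A → ℤ} → (∀ {z} → z ∈ xs → f z ≡ 0ℤ) → ∑ xs f ≡ 0ℤ
  ∑-zero []       f≗0 = refl
  ∑-zero (x ∷ xs) f≗0 = cong₂ _+_ (f≗0 (here refl)) (∑-zero xs (f≗0 ∘ there))

  ∑-+ : ∀ (xs : List A) {f g : A → ℤ} → ∑[ z ← xs ] (f z + g z) ≡ ∑ xs f + ∑ xs g
  ∑-+ []                 = refl
  ∑-+ (x ∷ xs) {f} {g} = trans (cong (f x + g x +_) (∑-+ xs)) (interchange (f x) (g x) _ _)

  ∑-*ˡ : ∀ (xs : List A) (k : ℤ) (f : A → ℤ) → ∑[ z ← xs ] (k * f z) ≡ k * ∑ xs f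
  ∑-*ˡ []       k f = sym (ℤₚ.*-zeroʳ k)
  ∑-*ˡ (x ∷ xs) k f = trans (cong (k * f x +_) (∑-*ˡ xs k f)) (sym (ℤₚ.*-distribˡ-+ k (f x) _))

  ∑-*ʳ : ∀ (xs : List A) (k : ℤ) (f : A → ℤ) → ∑[ z ← xs ] (f z * k) ≡ ∑ xs f * k
  ∑-*ʳ []       k f = refl
  ∑-*ʳ (x ∷ xs) k f = trans (cong (f x * k +_) (∑-*ʳ xs k f)) (sym (ℤₚ.*-distribʳ-+ k (f x) _))

  ∑-++ : ∀ (xs ys : List A) (f : A → ℤ) → ∑ (xs ++ ys) f ≡ ∑ xs f + ∑ ys f
  ∑-++ []       ys f = sym (ℤₚ.+-identityˡ _)
  ∑-++ (x ∷ xs) ys f = trans (cong (f x +_) (∑-++ xs ys f)) (sym (ℤₚ.+-assoc (f x) _ _))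

  ∑-filter : ∀ {P : Pred A 0ℓ} (P? : Decidable₁ P) (xs : List A) (f : A → ℤ) →
             ∑ (filter P? xs) f ≡ ∑[ z ← xs ] [ does (P? z) ]· f z
  ∑-filter P? []       f = refl
  ∑-filter P? (x ∷ xs) f with does (P? x)
  ... | true  = cong (f x +_) (∑-filter P? xs f)
  ... | false = trans (∑-filter P? xs f) (sym (ℤₚ.+-identityˡ _))

  ∑-pick : ∀ (_≟_ : DecidableEquality A) (f : A → ℤ) {xs : List A} {y : A} →
           Unique xs → y ∈ xs → ∑[ z ← xs ] [ ⌊ z ≟ y ⌋ ]· f z ≡ f y
  ∑-pick _≟_ f {y ∷ ws} (y∉ws ∷ _) (here refl) = begin
      [ ⌊ y ≟ y ⌋ ]· f y + ∑[ z ← ws ] [ ⌊ z ≟ y ⌋ ]· f z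
    ≡⟨ cong₂ (λ b s → [ b ]· f y + s) (⌊⌋-true (y ≟ y) refl) (∑-zero ws off-y) ⟩
      f y + 0ℤ
    ≡⟨ ℤₚ.+-identityʳ (f y) ⟩
      f y ∎
    where
    off-y : ∀ {z} → z ∈ ws → [ ⌊ z ≟ y ⌋ ]· f z ≡ 0ℤ
    off-y z∈ws = cong (λ b → [ b ]· _) (⌊⌋-false (_ ≟ y) (All.lookup y∉ws z∈ws ∘ sym))
  ∑-pick _≟_ f {w ∷ ws} {y} (w∉ws ∷ ws-unique) (there y∈ws) = begin
      [ ⌊ w ≟ y ⌋ ]· f w + ∑[ z ← ws ] [ ⌊ z ≟ y ⌋ ]· f z
    ≡⟨ cong₂ (λ b s → [ b ]· f w + s) (⌊⌋-false (w ≟ y) (All.lookup w∉ws y∈ws))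
                                      (∑-pick _≟_ f ws-unique y∈ws) ⟩
      0ℤ + f y
    ≡⟨ ℤₚ.+-identityˡ (f y) ⟩
      f y ∎

∑-map : ∀ {A B : Set} (g : A → B) (xs : List A) (f : B → ℤ) → ∑ (map g xs) f ≡ ∑[ x ← xs ] f (g x)
∑-map g xs f = cong sumℤ (sym (Listₚ.map-∘ xs))

module _ {A B : Set} where

  ∑-cartesianProduct : ∀ (xs : List A) (ys : List B) (f : A × B → ℤ) →
    ∑ (cartesianProduct xs ys) f ≡ ∑[ x ← xs ] ∑[ y ← ys ] f (x , y)
  ∑-cartesianProduct []       ys f = refl
  ∑-cartesianProduct (x ∷ xs) ys f = begin
      ∑ (map (x ,_) ys ++ cartesianProduct xs ys) f
    ≡⟨ ∑-++ (map (x ,_) ys) _ f ⟩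
      ∑ (map (x ,_) ys) f + ∑ (cartesianProduct xs ys) f
    ≡⟨ cong₂ _+_ (∑-map (x ,_) ys f) (∑-cartesianProduct xs ys f) ⟩
      ∑[ y ← ys ] f (x , y) + ∑[ x′ ← xs ] ∑[ y ← ys ] f (x′ , y) ∎

  ∑-product : ∀ (xs : List A) (ys : List B) (f : A → ℤ) (g : B → ℤ) →
    ∑[ x ← xs ] ∑[ y ← ys ] (f x * g y) ≡ ∑ xs f * ∑ ys g
  ∑-product xs ys f g = trans (∑-cong xs (λ x → ∑-*ˡ ys (f x) g)) (∑-*ʳ xs (∑ ys g) f)

countᵇ : {A : Set} → (A → Bool) → List A → ℕ
countᵇ p []       = 0
countᵇ p (z ∷ zs) = if p z then suc (countᵇ p zs) else countᵇ p zs

module _ {A : Set} where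

  countᵇ-≤-length : ∀ (p : A → Bool) zs → countᵇ p zs ≤ length zs
  countᵇ-≤-length p []       = z≤n
  countᵇ-≤-length p (z ∷ zs) with p z
  ... | true  = s≤s (countᵇ-≤-length p zs)
  ... | false = ℕₚ.m≤n⇒m≤1+n (countᵇ-≤-length p zs)

  countᵇ-mono : ∀ {p q : A → Bool} → (∀ {w} → p w ≡ true → q w ≡ true) →
                ∀ zs → countᵇ p zs ≤ countᵇ q zs
  countᵇ-mono             p⊆q []       = z≤n
  countᵇ-mono {p} {q} p⊆q (z ∷ zs) with p z in pz | q z in qz
  ... | true  | true  = s≤s (countᵇ-mono p⊆q zs)
  ... | true  | false with () ← trans (sym (p⊆q pz)) qz
  ... | false | true  = ℕₚ.m≤n⇒m≤1+n (countᵇ-mono p⊆q zs)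
  ... | false | false = countᵇ-mono p⊆q zs

  countᵇ-< : ∀ {p q : A → Bool} → (∀ {w} → p w ≡ true → q w ≡ true) →
             ∀ {zs z} → z ∈ zs → p z ≡ false → q z ≡ true → countᵇ p zs < countᵇ q zs
  countᵇ-< {p} {q} p⊆q {z ∷ zs} (here refl) pz qz rewrite pz | qz = s≤s (countᵇ-mono p⊆q zs)
  countᵇ-< {p} {q} p⊆q {w ∷ zs} (there z∈) pz qz with p w in pw | q w in qw
  ... | true  | true  = s≤s (countᵇ-< p⊆q z∈ pz qz)
  ... | true  | false with () ← trans (sym (p⊆q pw)) qw
  ... | false | true  = ℕₚ.m<n⇒m<1+n (countᵇ-< p⊆q z∈ pz qz)
  ... | false | false = countᵇ-< p⊆q z∈ pz qz

module PosetMöbius {A : Set} (_≟_ : DecidableEquality A) (le : A → A → Bool) (elems : List A)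
  (elems-unique : Unique elems)
  (le-refl : ∀ a → le a a ≡ true)
  (le-trans : ∀ {a b c} → le a b ≡ true → le b c ≡ true → le a c ≡ true)
  (le-antisym : ∀ {a b} → le a b ≡ true → le b a ≡ true → a ≡ b) where

  open Möbius _≟_ le elems using (mobF; μ)

  closed : A → A → A → Bool
  closed x y z = le x z && le z y

  halfOpen : A → A → A → Bool
  halfOpen x y z = le x z && le z y && not ⌊ z ≟ y ⌋

  halfOpen-parts : ∀ {x y z} → halfOpen x y z ≡ true → le x z ≡ true × le z y ≡ true × z ≢ y
  halfOpen-parts {x} {y} {z} h with &&-true {le x z} h
  ... | x≤z , h′ with &&-true h′
  ... | z≤y , z≉y = x≤z , z≤y , not⌊⌋-sound (z ≟ y) z≉y

  δ : A → A → ℤ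
  δ x y = [ ⌊ x ≟ y ⌋ ]· 1ℤ

  δ-≡ : ∀ {x y} → x ≡ y → δ x y ≡ 1ℤ
  δ-≡ {x} {y} x≡y = cong (λ b → [ b ]· 1ℤ) (⌊⌋-true (x ≟ y) x≡y)

  δ-≢ : ∀ {x y} → x ≢ y → δ x y ≡ 0ℤ
  δ-≢ {x} {y} x≢y = cong (λ b → [ b ]· 1ℤ) (⌊⌋-false (x ≟ y) x≢y)

  -- the rank of y, the number of elements strictly below y, bounds chain lengths
  strictlyBelow : A → A → Bool
  strictlyBelow y z = le z y && not ⌊ z ≟ y ⌋

  rank : A → ℕ
  rank y = countᵇ (strictlyBelow y) elems

  rank-bound : ∀ y → rank y < suc (length elems)
  rank-bound y = s≤s (countᵇ-≤-length (strictlyBelow y) elems)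

  rank-< : ∀ {y z} → z ∈ elems → le z y ≡ true → z ≢ y → rank z < rank y
  rank-< {y} {z} z∈ z≤y z≢y = countᵇ-< below-z⇒below-y z∈ z-not-below-z z-below-y
    where
    below-z⇒below-y : ∀ {w} → strictlyBelow z w ≡ true → strictlyBelow y w ≡ true
    below-z⇒below-y {w} w<z with &&-true {le w z} w<z
    ... | w≤z , w≉z = cong₂ _&&_ (le-trans w≤z z≤y) (cong not (⌊⌋-false (w ≟ y) w≢y))
      where
      w≢y : w ≢ y
      w≢y refl = not⌊⌋-sound (w ≟ z) w≉z (le-antisym w≤z z≤y)
    z-not-below-z : strictlyBelow z z ≡ false
    z-not-below-z rewrite le-refl z | ⌊⌋-true (z ≟ z) refl = refl
    z-below-y : strictlyBelow y z ≡ true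
    z-below-y = cong₂ _&&_ z≤y (cong not (⌊⌋-false (z ≟ y) z≢y))

  -- recursive calls on [x, y) use less fuel than the call on y
  halfOpen-rank : ∀ {x y z k} → z ∈ elems → halfOpen x y z ≡ true → rank y < suc k → rank z < k
  halfOpen-rank z∈ h r with halfOpen-parts h
  ... | _ , z≤y , z≢y = ℕₚ.<-≤-trans (rank-< z∈ z≤y z≢y) (ℕₚ.≤-pred r)

  mobF-stable : ∀ k k′ {x y} → rank y < k → rank y < k′ → mobF k x y ≡ mobF k′ x y
  mobF-stable (suc k) (suc k′) {x} {y} r r′ with x ≟ y
  ... | yes _ = refl
  ... | no  _ = cong (λ s → if le x y then - s else 0ℤ) (∑-cong-∈ elems agree)
    where
    agree : ∀ {z} → z ∈ elems → [ halfOpen x y z ]· mobF k x z ≡ [ halfOpen x y z ]· mobF k′ x z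
    agree {z} z∈ with halfOpen x y z in h
    ... | false = refl
    ... | true  = mobF-stable k k′ (halfOpen-rank z∈ h r) (halfOpen-rank z∈ h r′)

  μ-≡ : ∀ {x y} → x ≡ y → μ x y ≡ 1ℤ
  μ-≡ {x} refl with x ≟ x
  ... | yes _   = refl
  ... | no  x≢x = ⊥-elim (x≢x refl)

  μ-rec : ∀ {x y} → x ≢ y → le x y ≡ true → μ x y ≡ - (∑[ z ← elems ] [ halfOpen x y z ]· μ x z)
  μ-rec {x} {y} x≢y x≤y with x ≟ y
  ... | yes x≡y = ⊥-elim (x≢y x≡y)
  ... | no  _ rewrite x≤y = cong -_ (∑-cong-∈ elems agree)
    where
    agree : ∀ {z} → z ∈ elems → [ halfOpen x y z ]· mobF (length elems) x z ≡ [ halfOpen x y z ]· μ x z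
    agree {z} z∈ with halfOpen x y z in h
    ... | false = refl
    ... | true  = mobF-stable _ _ z<len (ℕₚ.m<n⇒m<1+n z<len)
      where z<len = halfOpen-rank z∈ h (rank-bound y)

  μ-unique : ∀ {x} (G : A → ℤ) → G x ≡ 1ℤ →
    (∀ {y} → y ∈ elems → le x y ≡ true → x ≢ y → G y ≡ - (∑[ z ← elems ] [ halfOpen x y z ]· G z)) →
    ∀ {y} → y ∈ elems → le x y ≡ true → μ x y ≡ G y
  μ-unique {x} G G-x G-rec {y} = agree-below (suc (length elems)) (rank-bound y)
    where
    agree-below : ∀ k {y} → rank y < k → y ∈ elems → le x y ≡ true → μ x y ≡ G y
    agree-below (suc k) {y} r y∈ x≤y = by-cases (x ≟ y)
      where
      agree : ∀ {z} → z ∈ elems → [ halfOpen x y z ]· μ x z ≡ [ halfOpen x y z ]· G z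
      agree {z} z∈ with halfOpen x y z in h
      ... | false = refl
      ... | true  = agree-below k (halfOpen-rank z∈ h r) z∈ (proj₁ (halfOpen-parts h))
      by-cases : Dec (x ≡ y) → μ x y ≡ G y
      by-cases (yes x≡y) = trans (μ-≡ x≡y) (sym (subst (λ t → G t ≡ 1ℤ) x≡y G-x))
      by-cases (no  x≢y) = begin
        μ x y                                        ≡⟨ μ-rec x≢y x≤y ⟩
        - (∑[ z ← elems ] [ halfOpen x y z ]· μ x z) ≡⟨ cong -_ (∑-cong-∈ elems agree) ⟩
        - (∑[ z ← elems ] [ halfOpen x y z ]· G z)   ≡⟨ sym (G-rec y∈ x≤y x≢y) ⟩
        G y                                          ∎

  closed-split : ∀ {x y} (h : A → ℤ) → y ∈ elems → le x y ≡ true →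
    ∑[ z ← elems ] [ closed x y z ]· h z ≡ ∑[ z ← elems ] [ halfOpen x y z ]· h z + h y
  closed-split {x} {y} h y∈ x≤y = begin
      ∑[ z ← elems ] [ closed x y z ]· h z
    ≡⟨ ∑-cong elems (λ z → split-top (le x z) (le z y) ⌊ z ≟ y ⌋ (h z)) ⟩
      ∑[ z ← elems ] ([ halfOpen x y z ]· h z + [ ⌊ z ≟ y ⌋ ]· [ closed x y z ]· h z)
    ≡⟨ ∑-+ elems ⟩
      ∑[ z ← elems ] [ halfOpen x y z ]· h z + ∑[ z ← elems ] [ ⌊ z ≟ y ⌋ ]· [ closed x y z ]· h z
    ≡⟨ cong (S +_) (∑-pick _≟_ (λ z → [ closed x y z ]· h z) elems-unique y∈) ⟩
      S + [ le x y && le y y ]· h y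
    ≡⟨ cong (λ b → S + [ b ]· h y) (cong₂ _&&_ x≤y (le-refl y)) ⟩
      S + h y ∎
    where
    S : ℤ
    S = ∑[ z ← elems ] [ halfOpen x y z ]· h z

  halfOpen-empty : ∀ {x y} (h : A → ℤ) → le y x ≡ true → ∑[ z ← elems ] [ halfOpen x y z ]· h z ≡ 0ℤ
  halfOpen-empty {x} {y} h y≤x = ∑-zero elems (λ {z} _ → vanish z)
    where
    vanish : ∀ z → [ halfOpen x y z ]· h z ≡ 0ℤ
    vanish z with halfOpen x y z in e
    ... | false = refl
    ... | true with halfOpen-parts e
    ... | x≤z , z≤y , z≢y = ⊥-elim (z≢y (le-antisym z≤y (le-trans y≤x x≤z)))

  μ-sum : ∀ {x y} → y ∈ elems → le x y ≡ true → ∑[ z ← elems ] [ closed x y z ]· μ x z ≡ δ x y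
  μ-sum {x} {y} y∈ x≤y = trans (closed-split (μ x) y∈ x≤y) (top (x ≟ y))
    where
    S : ℤ
    S = ∑[ z ← elems ] [ halfOpen x y z ]· μ x z
    top : Dec (x ≡ y) → S + μ x y ≡ δ x y
    top (yes x≡y) = begin
      S + μ x y  ≡⟨ cong₂ _+_ (halfOpen-empty (μ x) (subst (λ t → le t x ≡ true) x≡y (le-refl x)))
                              (μ-≡ x≡y) ⟩
      1ℤ         ≡⟨ sym (δ-≡ x≡y) ⟩
      δ x y      ∎
    top (no x≢y) = begin
      S + μ x y  ≡⟨ cong (S +_) (μ-rec x≢y x≤y) ⟩
      S + - S    ≡⟨ ℤₚ.+-inverseʳ S ⟩
      0ℤ         ≡⟨ sym (δ-≢ x≢y) ⟩
      δ x y      ∎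

  μ-unique-closed : ∀ {x} (G : A → ℤ) → x ∈ elems →
    (∀ {y} → y ∈ elems → le x y ≡ true → ∑[ z ← elems ] [ closed x y z ]· G z ≡ δ x y) →
    ∀ {y} → y ∈ elems → le x y ≡ true → μ x y ≡ G y
  μ-unique-closed {x} G x∈ G-sum = μ-unique G G-x G-rec
    where
    G-x : G x ≡ 1ℤ
    G-x = begin
      G x                                          ≡⟨ sym (ℤₚ.+-identityˡ (G x)) ⟩
      0ℤ + G x                                     ≡⟨ cong (_+ G x) (sym (halfOpen-empty G (le-refl x))) ⟩
      ∑[ z ← elems ] [ halfOpen x x z ]· G z + G x ≡⟨ sym (closed-split G x∈ (le-refl x)) ⟩
      ∑[ z ← elems ] [ closed x x z ]· G z         ≡⟨ G-sum x∈ (le-refl x) ⟩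
      δ x x                                        ≡⟨ δ-≡ refl ⟩
      1ℤ                                           ∎
    G-rec : ∀ {y} → y ∈ elems → le x y ≡ true → x ≢ y →
            G y ≡ - (∑[ z ← elems ] [ halfOpen x y z ]· G z)
    G-rec y∈ x≤y x≢y = inverseʳ-unique _ _
      (trans (sym (closed-split G y∈ x≤y)) (trans (G-sum y∈ x≤y) (δ-≢ x≢y)))

-- Boolean bookkeeping behind the factorisation of the interval sum:
-- [c ≤ d] [(x₀,y₀) ≤ (c,d) ≤ (a,b)] [c ≤ y₀] u v = [x₀ ≤ c ≤ a, c ≤ y₀] u · [y₀ ≤ d ≤ b] v,
-- since c ≤ y₀ ≤ d forces c ≤ d.  The booleans stand for
-- c ≤ d, x₀ ≤ c, y₀ ≤ d, c ≤ a, d ≤ b and c ≤ y₀.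
indicator-factor : ∀ (cd x₀c y₀d ca db cy₀ : Bool) (u v : ℤ) → (cy₀ ≡ true → y₀d ≡ true → cd ≡ true) →
  [ cd ]· [ (x₀c && y₀d) && (ca && db) ]· [ cy₀ ]· (u * v) ≡ ([ x₀c && ca && cy₀ ]· u) * ([ y₀d && db ]· v)
indicator-factor false true  true  true  true  true  u v forced with () ← forced refl refl
indicator-factor cd    false y₀d   ca    db    cy₀   u v _ with cd
... | true  = refl
... | false = refl
indicator-factor cd    true  false ca    db    cy₀   u v _ with cd
... | true  = sym (ℤₚ.*-zeroʳ ([ ca && cy₀ ]· u))
... | false = sym (ℤₚ.*-zeroʳ ([ ca && cy₀ ]· u))
indicator-factor cd    true  true  false db    cy₀   u v _ with cd
... | true  = refl
... | false = refl
indicator-factor cd    true  true  true  false cy₀   u v _ with cd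
... | true  = sym (ℤₚ.*-zeroʳ ([ cy₀ ]· u))
... | false = sym (ℤₚ.*-zeroʳ ([ cy₀ ]· u))
indicator-factor cd    true  true  true  true  false u v _ with cd
... | true  = refl
... | false = refl
indicator-factor true  true  true  true  true  true  u v _ = refl

module IntervalMöbius {n : ℕ} (_≤ᴸ_ : Fin n → Fin n → Set) (_⊔_ _⊓_ : Op₂ (Fin n))
  (isLattice : IsLattice _≡_ _≤ᴸ_ _⊔_ _⊓_) (_≤?_ : Decidable _≤ᴸ_) where

  open FinLattice _≤ᴸ_ _≤?_
  private module L = IsLattice isLattice

  leL-refl : ∀ a → leL a a ≡ true
  leL-refl a = ⌊⌋-true (a ≤? a) L.refl

  leL-trans : ∀ {a b c} → leL a b ≡ true → leL b c ≡ true → leL a c ≡ true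
  leL-trans {a} {b} {c} p q = ⌊⌋-true (a ≤? c) (L.trans (⌊⌋-sound (a ≤? b) p) (⌊⌋-sound (b ≤? c) q))

  leL-antisym : ∀ {a b} → leL a b ≡ true → leL b a ≡ true → a ≡ b
  leL-antisym {a} {b} p q = L.antisym (⌊⌋-sound (a ≤? b) p) (⌊⌋-sound (b ≤? a) q)

  leL-meet : ∀ c a b → leL c (a ⊓ b) ≡ leL c a && leL c b
  leL-meet c a b with c ≤? a | c ≤? b
  ... | yes c≤a | yes c≤b = ⌊⌋-true (c ≤? (a ⊓ b)) (L.∧-greatest c≤a c≤b)
  ... | no c≰a  | _       = ⌊⌋-false (c ≤? (a ⊓ b)) (λ c≤m → c≰a (L.trans c≤m (L.x∧y≤x a b)))
  ... | yes _   | no c≰b  = ⌊⌋-false (c ≤? (a ⊓ b)) (λ c≤m → c≰b (L.trans c≤m (L.x∧y≤y a b)))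

  meet-of-≤ : ∀ {a b} → a ≤ᴸ b → a ⊓ b ≡ a
  meet-of-≤ a≤b = L.antisym (L.x∧y≤x _ _) (L.∧-greatest L.refl a≤b)

  module ML = PosetMöbius _≟ᶠ_ leL (allFin n) (allFin⁺ n) leL-refl leL-trans leL-antisym

  isInterval : Decidable₁ (λ (p : Fin n × Fin n) → proj₁ p ≤ᴸ proj₂ p)
  isInterval p = proj₁ p ≤? proj₂ p

  intervals-as-product : intervals ≡ filter isInterval (cartesianProduct (allFin n) (allFin n))
  intervals-as-product = cong (filter isInterval) (pairs (allFin n) (allFin n))
    where
    pairs : ∀ (xs ys : List (Fin n)) → concatMap (λ x → map (x ,_) ys) xs ≡ cartesianProduct xs ys
    pairs []       ys = refl
    pairs (x ∷ xs) ys = cong (map (x ,_) ys ++_) (pairs xs ys)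

  intervals-unique : Unique intervals
  intervals-unique rewrite intervals-as-product =
    filter⁺ isInterval (cartesianProduct⁺ (allFin⁺ n) (allFin⁺ n))

  ∈-intervals : ∀ {a b} → a ≤ᴸ b → (a , b) ∈ intervals
  ∈-intervals {a} {b} a≤b rewrite intervals-as-product =
    ∈-filter⁺ isInterval (∈-cartesianProduct⁺ (∈-allFin a) (∈-allFin b)) a≤b

  ∈-intervals⁻ : ∀ {a b} → (a , b) ∈ intervals → a ≤ᴸ b
  ∈-intervals⁻ p∈ rewrite intervals-as-product = proj₂ (∈-filter⁻ isInterval {xs = cartesianProduct (allFin n) (allFin n)} p∈)

  ∑-intervals : ∀ (h : Fin n × Fin n → ℤ) →
    ∑ intervals h ≡ ∑[ c ← allFin n ] ∑[ d ← allFin n ] [ leL c d ]· h (c , d)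
  ∑-intervals h = begin
      ∑ intervals h
    ≡⟨ cong (λ ps → ∑ ps h) intervals-as-product ⟩
      ∑ (filter isInterval (cartesianProduct (allFin n) (allFin n))) h
    ≡⟨ ∑-filter isInterval (cartesianProduct (allFin n) (allFin n)) h ⟩
      ∑[ p ← cartesianProduct (allFin n) (allFin n) ] [ does (isInterval p) ]· h p
    ≡⟨ ∑-cartesianProduct (allFin n) (allFin n) _ ⟩
      ∑[ c ← allFin n ] ∑[ d ← allFin n ] [ does (c ≤? d) ]· h (c , d)
    ≡⟨ ∑-cong (allFin n) (λ c → ∑-cong (allFin n) (λ d →
         cong (λ b → [ b ]· h (c , d)) (sym (isYes≗does (c ≤? d))))) ⟩
      ∑[ c ← allFin n ] ∑[ d ← allFin n ] [ leL c d ]· h (c , d) ∎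

  leInt-refl : ∀ p → leInt p p ≡ true
  leInt-refl (a , b) = cong₂ _&&_ (leL-refl a) (leL-refl b)

  leInt-trans : ∀ {p q r} → leInt p q ≡ true → leInt q r ≡ true → leInt p r ≡ true
  leInt-trans {a , b} {c , d} {e , f} p≤q q≤r with &&-true {leL a c} p≤q | &&-true {leL c e} q≤r
  ... | a≤c , b≤d | c≤e , d≤f = cong₂ _&&_ (leL-trans a≤c c≤e) (leL-trans b≤d d≤f)

  leInt-antisym : ∀ {p q} → leInt p q ≡ true → leInt q p ≡ true → p ≡ q
  leInt-antisym {a , b} {c , d} p≤q q≤p with &&-true {leL a c} p≤q | &&-true {leL c a} q≤p
  ... | a≤c , b≤d | c≤a , d≤b = cong₂ _,_ (leL-antisym a≤c c≤a) (leL-antisym b≤d d≤b)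

  module MI = PosetMöbius (≡-dec _≟ᶠ_ _≟ᶠ_) leInt intervals intervals-unique
                          leInt-refl leInt-trans leInt-antisym

  δ-pair : ∀ a b c d → MI.δ (a , b) (c , d) ≡ ML.δ a c * ML.δ b d
  δ-pair a b c d = by-cases (a ≟ᶠ c) (b ≟ᶠ d)
    where
    by-cases : Dec (a ≡ c) → Dec (b ≡ d) → MI.δ (a , b) (c , d) ≡ ML.δ a c * ML.δ b d
    by-cases (yes a≡c) (yes b≡d) = trans (MI.δ-≡ (cong₂ _,_ a≡c b≡d))
                                         (sym (cong₂ _*_ (ML.δ-≡ a≡c) (ML.δ-≡ b≡d)))
    by-cases (no a≢c)  _         = trans (MI.δ-≢ (a≢c ∘ cong proj₁))
                                         (sym (cong (_* ML.δ b d) (ML.δ-≢ a≢c)))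
    by-cases (yes _)   (no b≢d)  = trans (MI.δ-≢ (b≢d ∘ cong proj₂))
                                         (sym (trans (cong (ML.δ a c *_) (ML.δ-≢ b≢d)) (ℤₚ.*-zeroʳ (ML.δ a c))))

  module Candidate (x₀ y₀ : Fin n) (x₀≤y₀ : x₀ ≤ᴸ y₀) where

    G : Fin n × Fin n → ℤ
    G (a , b) = [ leL a y₀ ]· (μL x₀ a * μL y₀ b)

    G-sum-factor : ∀ {a b} → leInt (x₀ , y₀) (a , b) ≡ true →
      ∑[ p ← intervals ] [ MI.closed (x₀ , y₀) (a , b) p ]· G p ≡ ML.δ x₀ (a ⊓ y₀) * ML.δ y₀ b
    G-sum-factor {a} {b} p₀≤q = begin
        ∑[ p ← intervals ] [ MI.closed (x₀ , y₀) (a , b) p ]· G p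
      ≡⟨ ∑-intervals _ ⟩
        ∑[ c ← allFin n ] ∑[ d ← allFin n ] [ leL c d ]· [ MI.closed (x₀ , y₀) (a , b) (c , d) ]· G (c , d)
      ≡⟨ ∑-cong (allFin n) (λ c → ∑-cong (allFin n) (λ d → factor c d)) ⟩
        ∑[ c ← allFin n ] ∑[ d ← allFin n ] (F c * H d)
      ≡⟨ ∑-product (allFin n) (allFin n) F H ⟩
        ∑ (allFin n) F * ∑ (allFin n) H
      ≡⟨ cong₂ _*_ (ML.μ-sum (∈-allFin _) x₀≤a⊓y₀) (ML.μ-sum (∈-allFin b) y₀≤b) ⟩
        ML.δ x₀ (a ⊓ y₀) * ML.δ y₀ b ∎
      where
      F H : Fin n → ℤ
      F c = [ ML.closed x₀ (a ⊓ y₀) c ]· μL x₀ c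
      H d = [ ML.closed y₀ b d ]· μL y₀ d
      factor : ∀ c d → [ leL c d ]· [ MI.closed (x₀ , y₀) (a , b) (c , d) ]· G (c , d) ≡ F c * H d
      factor c d rewrite leL-meet c a y₀ =
        indicator-factor (leL c d) (leL x₀ c) (leL y₀ d) (leL c a) (leL d b) (leL c y₀)
                         (μL x₀ c) (μL y₀ d) leL-trans
      x₀≤a⊓y₀ : leL x₀ (a ⊓ y₀) ≡ true
      x₀≤a⊓y₀ = trans (leL-meet x₀ a y₀) (cong₂ _&&_ (proj₁ (&&-true p₀≤q)) (⌊⌋-true (x₀ ≤? y₀) x₀≤y₀))
      y₀≤b : leL y₀ b ≡ true
      y₀≤b = proj₂ (&&-true {leL x₀ a} p₀≤q)

    -- δ(x₀, a ⊓ y₀) δ(y₀, b) = δ(x₀, a) δ(y₀, b) for a ≤ b: if y₀ = b then a ⊓ y₀ = a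
    δ-meet : ∀ {a b} → a ≤ᴸ b → ML.δ x₀ (a ⊓ y₀) * ML.δ y₀ b ≡ ML.δ x₀ a * ML.δ y₀ b
    δ-meet {a} {b} a≤b = by-cases (y₀ ≟ᶠ b)
      where
      by-cases : Dec (y₀ ≡ b) → ML.δ x₀ (a ⊓ y₀) * ML.δ y₀ b ≡ ML.δ x₀ a * ML.δ y₀ b
      by-cases (yes y₀≡b) = cong (λ m → ML.δ x₀ m * ML.δ y₀ b)
                                 (meet-of-≤ (subst (a ≤ᴸ_) (sym y₀≡b) a≤b))
      by-cases (no y₀≢b)  = begin
        ML.δ x₀ (a ⊓ y₀) * ML.δ y₀ b ≡⟨ cong (ML.δ x₀ (a ⊓ y₀) *_) (ML.δ-≢ y₀≢b) ⟩
        ML.δ x₀ (a ⊓ y₀) * 0ℤ        ≡⟨ ℤₚ.*-zeroʳ (ML.δ x₀ (a ⊓ y₀)) ⟩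
        0ℤ                           ≡⟨ sym (ℤₚ.*-zeroʳ (ML.δ x₀ a)) ⟩
        ML.δ x₀ a * 0ℤ               ≡⟨ cong (ML.δ x₀ a *_) (sym (ML.δ-≢ y₀≢b)) ⟩
        ML.δ x₀ a * ML.δ y₀ b        ∎

    μInt≡G : ∀ {a b} → a ≤ᴸ b → leInt (x₀ , y₀) (a , b) ≡ true → μInt (x₀ , y₀) (a , b) ≡ G (a , b)
    μInt≡G a≤b = MI.μ-unique-closed G (∈-intervals x₀≤y₀) G-sum (∈-intervals a≤b)
      where
      G-sum : ∀ {q} → q ∈ intervals → leInt (x₀ , y₀) q ≡ true →
              ∑[ p ← intervals ] [ MI.closed (x₀ , y₀) q p ]· G p ≡ MI.δ (x₀ , y₀) q
      G-sum {a , b} q∈ p₀≤q = begin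
        ∑[ p ← intervals ] [ MI.closed (x₀ , y₀) (a , b) p ]· G p ≡⟨ G-sum-factor p₀≤q ⟩
        ML.δ x₀ (a ⊓ y₀) * ML.δ y₀ b                              ≡⟨ δ-meet (∈-intervals⁻ q∈) ⟩
        ML.δ x₀ a * ML.δ y₀ b                                     ≡⟨ sym (δ-pair x₀ y₀ a b) ⟩
        MI.δ (x₀ , y₀) (a , b)                                    ∎

theorem5p2 : {n : ℕ} (_≤_ : Fin n → Fin n → Set) (_∨_ _∧_ : Op₂ (Fin n))
    → IsLattice _≡_ _≤_ _∨_ _∧_
    → (_≤?_ : Decidable _≤_)
    → (x y x' y' : Fin n) → x ≤ y → x' ≤ y' → x ≤ x' → y ≤ y'
    → (x' ≤ y → FinLattice.μInt _≤_ _≤?_ (x , y) (x' , y')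
                  ≡ FinLattice.μL _≤_ _≤?_ x x' * FinLattice.μL _≤_ _≤?_ y y')
      × (¬ (x' ≤ y) → FinLattice.μInt _≤_ _≤?_ (x , y) (x' , y') ≡ 0ℤ)
theorem5p2 _≤_ _∨_ _∧_ isLattice _≤?_ x y x' y' x≤y x'≤y' x≤x' y≤y' =
    (λ x'≤y  → trans μInt-value (cong (λ b → [ b ]· μL-product) (⌊⌋-true (x' ≤? y) x'≤y)))
  , (λ x'≰y → trans μInt-value (cong (λ b → [ b ]· μL-product) (⌊⌋-false (x' ≤? y) x'≰y)))
  where
  open IntervalMöbius _≤_ _∨_ _∧_ isLattice _≤?_
  open Candidate x y x≤y
  μL-product : ℤ
  μL-product = FinLattice.μL _≤_ _≤?_ x x' * FinLattice.μL _≤_ _≤?_ y y'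
  μInt-value : FinLattice.μInt _≤_ _≤?_ (x , y) (x' , y') ≡ G (x' , y')
  μInt-value = μInt≡G x'≤y' (cong₂ _&&_ (⌊⌋-true (x ≤? x') x≤x') (⌊⌋-true (y ≤? y') y≤y'))
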